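{- There exists a polynomial $p$ such that for all positive integers $n$, $a$, $b$, the second player has a winning strategy in the rectangle game with parameters $n,a,b$ and $k=p(n)$, defined as follows. The game is played on the board $\mathbb{B}^n\times\mathbb{B}^n$, where $\mathbb{B}^n$ is the set of binary strings of length $n$. It lasts $T=ab$ rounds. In each round, the first player chooses a combinatorial rectangle $R\subseteq \mathbb{B}^n\times\mathbb{B}^n$, i.e., a set of the form $R=U\times V$ with $U,V\subseteq\mathbb{B}^n$, which must be disjoint from all rectangles chosen in previous rounds; the second player, having seen this rectangle, then labels it either ``horizontal'' or ``vertical''. Both players see all previous moves. After all $T$ rounds, the second player wins if and only if (i) for every $y\in\mathbb{B}^n$, the horizontal line $\mathbb{B}^n\times\{y\}$ intersects at most $ka$ of the rectangles labeled horizontal, and (ii) for every $x\in\mathbb{B}^n$, the vertical line $\{x\}\times\mathbb{B}^n$ intersects at most $kb$ of the rectangles labeled vertical.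
   Context: $\mathbb{B}^n$ denotes the set of binary strings of length $n$. A combinatorial rectangle in $\mathbb{B}^n\times\mathbb{B}^n$ is a set of the form $U\times V$ with $U,V\subseteq\mathbb{B}^n$. The polynomial $p$ does not depend on $n$, $a$, $b$. -}

module Defs where

open import Data.Nat using (ℕ; zero; suc; _+_; _*_; _≤_)
open import Data.Bool using (Bool; true; false; _∧_)
open import Data.List using (List; []; _∷_; _++_; map)
open import Data.Bool.ListAction using (any)
open import Data.Vec using (Vec; []; _∷_)
open import Data.Product using (Σ; _×_; _,_)
open import Data.Empty using (⊥)
open import Relation.Binary.PropositionalEquality using (_≡_)

𝔹 : ℕ → Set
𝔹 n = Vec Bool n

all𝔹 : (n : ℕ) → List (𝔹 n)
all𝔹 zero = [] ∷ []
all𝔹 (suc n) = map (true ∷_) (all𝔹 n) ++ map (false ∷_) (all𝔹 n)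

Subset𝔹 : ℕ → Set
Subset𝔹 n = 𝔹 n → Bool

record Rect (n : ℕ) : Set where
  constructor _⊠_
  field
    U : Subset𝔹 n
    V : Subset𝔹 n
open Rect public

_∈R_ : {n : ℕ} → 𝔹 n × 𝔹 n → Rect n → Set
(x , y) ∈R R = (U R x ∧ V R y) ≡ true

DisjointR : {n : ℕ} → Rect n → Rect n → Set
DisjointR {n} R S = (x y : 𝔹 n) → (x , y) ∈R R → (x , y) ∈R S → ⊥

data Label : Set where
  horizontal vertical : Label

-- history of the game: list of (rectangle, label) pairs, most recent first
History : ℕ → Set
History n = List (Rect n × Label)

Fresh : {n : ℕ} → Rect n → History n → Set
Fresh R [] = Data.Unit.⊤ where import Data.Unit
Fresh R ((S , _) ∷ h) = DisjointR R S × Fresh R h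

-- the horizontal line 𝔹ⁿ × {y} intersects U × V  iff  U ≠ ∅ and y ∈ V
hitsHLine : {n : ℕ} → 𝔹 n → Rect n → Bool
hitsHLine {n} y R = any (U R) (all𝔹 n) ∧ V R y

-- the vertical line {x} × 𝔹ⁿ intersects U × V  iff  x ∈ U and V ≠ ∅
hitsVLine : {n : ℕ} → 𝔹 n → Rect n → Bool
hitsVLine {n} x R = U R x ∧ any (V R) (all𝔹 n)

countH : {n : ℕ} → 𝔹 n → History n → ℕ
countH y [] = 0
countH y ((R , horizontal) ∷ h) with hitsHLine y R
... | true = suc (countH y h)
... | false = countH y h
countH y ((R , vertical) ∷ h) = countH y h

countV : {n : ℕ} → 𝔹 n → History n → ℕ
countV x [] = 0
countV x ((R , vertical) ∷ h) with hitsVLine x R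
... | true = suc (countV x h)
... | false = countV x h
countV x ((R , horizontal) ∷ h) = countV x h

SecondWins : (n a b k : ℕ) → History n → Set
SecondWins n a b k h =
  ((y : 𝔹 n) → countH y h ≤ k * a) × ((x : 𝔹 n) → countV x h ≤ k * b)

-- The second player has a winning strategy from history h with t rounds left:
-- for every legal rectangle of the first player there is a label (chosen
-- knowing the whole history and the rectangle) from which the second player
-- can still win.  (Constructively, an inhabitant is exactly a strategy.)
SecondWinsFrom : (n a b k t : ℕ) → History n → Set
SecondWinsFrom n a b k zero h = SecondWins n a b k h
SecondWinsFrom n a b k (suc t) h =
  (R : Rect n) → Fresh R h →
  Σ Label (λ l → SecondWinsFrom n a b k t ((R , l) ∷ h))

SecondHasWinningStrategy : (n a b k : ℕ) → Set
SecondHasWinningStrategy n a b k = SecondWinsFrom n a b k (a * b) []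

-- polynomials with natural-number coefficients c₀ + c₁ x + c₂ x² + …
evalPoly : List ℕ → ℕ → ℕ
evalPoly [] x = 0
evalPoly (c ∷ cs) x = c + x * evalPoly cs x

-- The second player labels greedily against an exponential potential. A line that has met
-- h rectangles of its own orientation gets weight 2^⌊h/a⌋ (rows; ⌊h/b⌋ for columns) and
-- potential 2^⌊h/a⌋·(a + h mod a), a discrete a·2^(h/a) that grows by exactly the weight
-- whenever the line meets one more rectangle. With
--   Φ = b·Σ_y potential(row y) + a·Σ_x potential(column x),
-- labelling R horizontal raises Φ by b·P_R and vertical by a·Q_R, where P_R (Q_R) is the
-- total weight of the rows (columns) meeting R; the player takes the smaller, which is at
-- most √(ab·P_R·Q_R). Weights only grow, so every round may be charged at the final weights.
-- A row and a column both meet R only if their crossing lies in R, so disjointness gives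
-- Σ_R P_R·Q_R ≤ (Σ row weights)(Σ column weights); Cauchy–Schwarz over the ab rounds and
-- AM–GM then bound the total increase by Φ_final/2. Hence Φ_final ≤ 2·Φ_initial = 4ab·2ⁿ,
-- so every row meets fewer than (n+3)a horizontal rectangles and every column fewer than
-- (n+3)b vertical ones: p(n) = n + 3.

module Submission where

open import Defs
open import Data.Bool using (Bool; true; false; _∧_)
open import Data.Bool.ListAction using (any)
open import Data.Empty using (⊥-elim)
open import Data.List using (List; []; _∷_; _++_; length; map)
open import Data.List.Membership.Propositional using (_∈_)
open import Data.List.Membership.Propositional.Properties using (∈-map⁺; ∈-++⁺ˡ; ∈-++⁺ʳ)
open import Data.List.Properties using (length-map; length-++)
open import Data.List.Relation.Unary.Any using (here; there)
open import Data.Nat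
open import Data.Nat.DivMod
open import Data.Nat.Properties
open import Algebra.Properties.CommutativeSemigroup +-commutativeSemigroup
  using () renaming (interchange to +-interchange)
open import Algebra.Properties.CommutativeSemigroup *-commutativeSemigroup
  using () renaming (interchange to *-interchange)
open import Data.Nat.Tactic.RingSolver using (solve)
open import Data.Product using (Σ; _×_; _,_; proj₁)
open import Data.Sum using (_⊎_; inj₁; inj₂; [_,_]′)
open import Data.Unit using (⊤)
open import Function using (_∘_)
open import Relation.Binary.PropositionalEquality
open import Relation.Nullary using (yes; no)
open import Relation.Nullary.Negation using (contradiction)

private variable
  A B : Set

m*m≤n*n⇒m≤n : ∀ m n → m * m ≤ n * n → m ≤ n
m*m≤n*n⇒m≤n m n m²≤n² with m ≤? n
... | yes m≤n = m≤n
... | no m≰n = contradiction m²≤n² (<⇒≱ (*-mono-< (≰⇒> m≰n) (≰⇒> m≰n)))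

^-cancelʳ-≤ : ∀ m {n o} → 1 < m → m ^ n ≤ m ^ o → n ≤ o
^-cancelʳ-≤ m {n} {o} 1<m mⁿ≤mᵒ with n ≤? o
... | yes n≤o = n≤o
... | no n≰o = contradiction mⁿ≤mᵒ (<⇒≱ (^-monoʳ-< m 1<m (≰⇒> n≰o)))

4*[m*n]≤[m+n]*[m+n] : ∀ m n → 4 * (m * n) ≤ (m + n) * (m + n)
4*[m*n]≤[m+n]*[m+n] m n = [ ordered , swapped ]′ (≤-total m n)
  where
  ordered : ∀ {m n} → m ≤ n → 4 * (m * n) ≤ (m + n) * (m + n)
  ordered {m} m≤n with m≤n⇒∃[o]m+o≡n m≤n
  ... | d , refl = begin
    4 * (m * (m + d))              ≤⟨ m≤m+n _ (d * d) ⟩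
    4 * (m * (m + d)) + d * d      ≡⟨ solve (m ∷ d ∷ []) ⟩
    (m + (m + d)) * (m + (m + d))  ∎
    where open ≤-Reasoning
  swapped : n ≤ m → 4 * (m * n) ≤ (m + n) * (m + n)
  swapped n≤m = subst₂ _≤_ (cong (4 *_) (*-comm n m)) (cong (λ s → s * s) (+-comm n m)) (ordered n≤m)

[m⊓n]*[m⊓n]≤m*n : ∀ m n → (m ⊓ n) * (m ⊓ n) ≤ m * n
[m⊓n]*[m⊓n]≤m*n m n = *-mono-≤ (m⊓n≤m m n) (m⊓n≤n m n)

m*m≤n*n*[o*p]⇒2*m≤n*o+n*p : ∀ m n o p → m * m ≤ n * n * (o * p) → 2 * m ≤ n * o + n * p
m*m≤n*n*[o*p]⇒2*m≤n*o+n*p m n o p m²≤n²op = m*m≤n*n⇒m≤n (2 * m) (n * o + n * p) (begin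
  2 * m * (2 * m)                  ≡⟨ solve (m ∷ []) ⟩
  4 * (m * m)                      ≤⟨ *-monoʳ-≤ 4 m²≤n²op ⟩
  4 * (n * n * (o * p))            ≡⟨ solve (n ∷ o ∷ p ∷ []) ⟩
  n * n * (4 * (o * p))            ≤⟨ *-monoʳ-≤ (n * n) (4*[m*n]≤[m+n]*[m+n] o p) ⟩
  n * n * ((o + p) * (o + p))      ≡⟨ solve (n ∷ o ∷ p ∷ []) ⟩
  (n * o + n * p) * (n * o + n * p) ∎)
  where open ≤-Reasoning

m≤n+o⇒2*o≤m⇒m≤2*n : ∀ {m n o} → m ≤ n + o → 2 * o ≤ m → m ≤ 2 * n
m≤n+o⇒2*o≤m⇒m≤2*n {m} {n} {o} m≤n+o 2o≤m = +-cancelʳ-≤ m m (2 * n) (begin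
  m + m            ≡⟨ solve (m ∷ []) ⟩
  2 * m            ≤⟨ *-monoʳ-≤ 2 m≤n+o ⟩
  2 * (n + o)      ≡⟨ *-distribˡ-+ 2 n o ⟩
  2 * n + 2 * o    ≤⟨ +-monoʳ-≤ (2 * n) 2o≤m ⟩
  2 * n + m        ∎)
  where open ≤-Reasoning

cauchy-schwarz-step : ∀ {s t q} u → s * s ≤ t * q → (u + s) * (u + s) ≤ suc t * (u * u + q)
cauchy-schwarz-step {s} {t} {q} u s²≤tq = begin
  (u + s) * (u + s)                   ≡⟨ solve (u ∷ s ∷ []) ⟩
  u * u + 2 * u * s + s * s           ≤⟨ +-mono-≤ (+-monoʳ-≤ (u * u) 2us≤q+tu²) s²≤tq ⟩
  u * u + (q + t * (u * u)) + t * q   ≡⟨ solve (u ∷ t ∷ q ∷ []) ⟩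
  suc t * (u * u + q)                 ∎
  where
  open ≤-Reasoning
  2us≤q+tu² : 2 * u * s ≤ q + t * (u * u)
  2us≤q+tu² = m*m≤n*n⇒m≤n _ _ (begin
    (2 * u * s) * (2 * u * s)       ≡⟨ solve (u ∷ s ∷ []) ⟩
    4 * (u * u) * (s * s)           ≤⟨ *-monoʳ-≤ (4 * (u * u)) s²≤tq ⟩
    4 * (u * u) * (t * q)           ≡⟨ solve (u ∷ t ∷ q ∷ []) ⟩
    4 * (q * (t * (u * u)))         ≤⟨ 4*[m*n]≤[m+n]*[m+n] q (t * (u * u)) ⟩
    (q + t * (u * u)) * (q + t * (u * u)) ∎)

∑ : List A → (A → ℕ) → ℕ
∑ []       f = 0
∑ (x ∷ xs) f = f x + ∑ xs f

syntax ∑ xs (λ x → e) = ∑[ x ∈ xs ] e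

∑-cong : ∀ (xs : List A) {f g : A → ℕ} → (∀ x → f x ≡ g x) → ∑ xs f ≡ ∑ xs g
∑-cong []       f≗g = refl
∑-cong (x ∷ xs) f≗g = cong₂ _+_ (f≗g x) (∑-cong xs f≗g)

∑-mono-≤ : ∀ (xs : List A) {f g : A → ℕ} → (∀ x → f x ≤ g x) → ∑ xs f ≤ ∑ xs g
∑-mono-≤ []       f≤g = z≤n
∑-mono-≤ (x ∷ xs) f≤g = +-mono-≤ (f≤g x) (∑-mono-≤ xs f≤g)

∑-distrib-+ : ∀ (xs : List A) (f g : A → ℕ) → ∑[ x ∈ xs ] (f x + g x) ≡ ∑ xs f + ∑ xs g
∑-distrib-+ []       f g = refl
∑-distrib-+ (x ∷ xs) f g = begin
  f x + g x + (∑[ x ∈ xs ] (f x + g x))  ≡⟨ cong (f x + g x +_) (∑-distrib-+ xs f g) ⟩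
  f x + g x + (∑ xs f + ∑ xs g)           ≡⟨ +-interchange (f x) (g x) (∑ xs f) (∑ xs g) ⟩
  f x + ∑ xs f + (g x + ∑ xs g)         ∎
  where open ≡-Reasoning

*-distribˡ-∑ : ∀ (xs : List A) c (f : A → ℕ) → c * ∑ xs f ≡ ∑[ x ∈ xs ] (c * f x)
*-distribˡ-∑ []       c f = *-zeroʳ c
*-distribˡ-∑ (x ∷ xs) c f = trans (*-distribˡ-+ c (f x) (∑ xs f)) (cong (c * f x +_) (*-distribˡ-∑ xs c f))

∑-const : ∀ (xs : List A) c → ∑[ x ∈ xs ] c ≡ c * length xs
∑-const []       c = sym (*-zeroʳ c)
∑-const (x ∷ xs) c = trans (cong (c +_) (∑-const xs c)) (sym (*-suc c (length xs)))

∈⇒≤∑ : ∀ {xs : List A} {x} (f : A → ℕ) → x ∈ xs → f x ≤ ∑ xs f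
∈⇒≤∑ f (here refl)  = m≤m+n _ _
∈⇒≤∑ f (there x∈xs) = ≤-trans (∈⇒≤∑ f x∈xs) (m≤n+m _ _)

*-distribʳ-∑ : ∀ (xs : List A) c (f : A → ℕ) → ∑ xs f * c ≡ ∑[ x ∈ xs ] (f x * c)
*-distribʳ-∑ []       c f = refl
*-distribʳ-∑ (x ∷ xs) c f = trans (*-distribʳ-+ c (f x) (∑ xs f)) (cong (f x * c +_) (*-distribʳ-∑ xs c f))

∑-comm : ∀ (xs : List A) (ys : List B) (f : A → B → ℕ) →
         ∑[ x ∈ xs ] ∑[ y ∈ ys ] f x y ≡ ∑[ y ∈ ys ] ∑[ x ∈ xs ] f x y
∑-comm []       ys f = sym (∑-const ys 0)
∑-comm (x ∷ xs) ys f = begin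
  ∑ ys (f x) + (∑[ x ∈ xs ] ∑[ y ∈ ys ] f x y)  ≡⟨ cong (∑ ys (f x) +_) (∑-comm xs ys f) ⟩
  ∑ ys (f x) + (∑[ y ∈ ys ] ∑[ x ∈ xs ] f x y)  ≡⟨ ∑-distrib-+ ys (f x) _ ⟨
  ∑[ y ∈ ys ] (f x y + (∑[ x ∈ xs ] f x y))     ∎
  where open ≡-Reasoning

∑*∑≡∑∑* : ∀ (xs : List A) (ys : List B) (f : A → ℕ) (g : B → ℕ) →
          ∑ xs f * ∑ ys g ≡ ∑[ x ∈ xs ] ∑[ y ∈ ys ] (f x * g y)
∑*∑≡∑∑* xs ys f g = trans (*-distribʳ-∑ xs (∑ ys g) f) (∑-cong xs (λ x → *-distribˡ-∑ ys (f x) g))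

cauchy-schwarz : ∀ (xs : List A) (f : A → ℕ) → ∑ xs f * ∑ xs f ≤ length xs * ∑[ x ∈ xs ] (f x * f x)
cauchy-schwarz []       f = z≤n
cauchy-schwarz (x ∷ xs) f = cauchy-schwarz-step {t = length xs} (f x) (cauchy-schwarz xs f)

∑⊓-cauchy-schwarz : ∀ (xs : List A) (f g : A → ℕ) →
  (∑[ x ∈ xs ] (f x ⊓ g x)) * (∑[ x ∈ xs ] (f x ⊓ g x)) ≤ length xs * ∑[ x ∈ xs ] (f x * g x)
∑⊓-cauchy-schwarz xs f g = ≤-trans (cauchy-schwarz xs (λ x → f x ⊓ g x))
  (*-monoʳ-≤ (length xs) (∑-mono-≤ xs (λ x → [m⊓n]*[m⊓n]≤m*n (f x) (g x))))

-- Vec's constructors are opened only here: elsewhere they would make the list of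
-- variables passed to the ring solver ambiguous.
module _ where
  open import Data.Vec using ([]; _∷_)

  ∈-all𝔹 : ∀ {n} (x : 𝔹 n) → x ∈ all𝔹 n
  ∈-all𝔹 []                    = here refl
  ∈-all𝔹 {suc n} (true ∷ x)  = ∈-++⁺ˡ (∈-map⁺ (true ∷_) (∈-all𝔹 x))
  ∈-all𝔹 {suc n} (false ∷ x) = ∈-++⁺ʳ (map (true ∷_) (all𝔹 n)) (∈-map⁺ (false ∷_) (∈-all𝔹 x))

  length-all𝔹 : ∀ n → length (all𝔹 n) ≡ 2 ^ n
  length-all𝔹 zero    = refl
  length-all𝔹 (suc n) = begin
    length (map (true ∷_) (all𝔹 n) ++ map (false ∷_) (all𝔹 n))  ≡⟨ length-++ (map (true ∷_) (all𝔹 n)) ⟩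
    length (map (true ∷_) (all𝔹 n)) + length (map (false ∷_) (all𝔹 n))
      ≡⟨ cong₂ _+_ (length-map (true ∷_) (all𝔹 n)) (length-map (false ∷_) (all𝔹 n)) ⟩
    length (all𝔹 n) + length (all𝔹 n)   ≡⟨ cong (λ m → m + m) (length-all𝔹 n) ⟩
    2 ^ n + 2 ^ n                       ≡⟨ cong (2 ^ n +_) (+-identityʳ (2 ^ n)) ⟨
    2 ^ suc n                           ∎
    where open ≡-Reasoning

∑-all𝔹-const : ∀ n c → ∑[ x ∈ all𝔹 n ] c ≡ c * 2 ^ n
∑-all𝔹-const n c = trans (∑-const (all𝔹 n) c) (cong (c *_) (length-all𝔹 n))

module Potential (a : ℕ) .{{_ : NonZero a}} where

  weight : ℕ → ℕ
  weight h = 2 ^ (h / a)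

  potential : ℕ → ℕ
  potential h = weight h * (a + h % a)

  potential-digits : ∀ {r} q → r < a → potential (r + q * a) ≡ 2 ^ q * (a + r)
  potential-digits {r} q r<a = cong₂ (λ q′ r′ → 2 ^ q′ * (a + r′)) quotient remainder
    where
    remainder : (r + q * a) % a ≡ r
    remainder = trans ([m+kn]%n≡m%n r q a) (m<n⇒m%n≡m r<a)
    no-carry : r % a + q * a % a < a
    no-carry = begin-strict
      r % a + q * a % a  ≡⟨ cong (r % a +_) (m*n%n≡0 q a) ⟩
      r % a + 0          ≡⟨ +-identityʳ (r % a) ⟩
      r % a              <⟨ m%n<n r a ⟩
      a                  ∎
      where open ≤-Reasoning
    quotient : (r + q * a) / a ≡ q
    quotient = begin
      (r + q * a) / a    ≡⟨ +-distrib-/ r (q * a) no-carry ⟩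
      r / a + q * a / a  ≡⟨ cong₂ _+_ (m<n⇒m/n≡0 r<a) (m*n/n≡m q a) ⟩
      q                  ∎
      where open ≡-Reasoning

  potential-suc : ∀ h → potential (suc h) ≡ potential h + weight h
  potential-suc h = begin
    potential (suc h)                    ≡⟨ cong (potential ∘ suc) (m≡m%n+[m/n]*n h a) ⟩
    potential (suc (h % a) + h / a * a)  ≡⟨ increment (m≤n⇒m<n∨m≡n (m%n<n h a)) ⟩
    weight h * (a + suc (h % a))         ≡⟨ cong (weight h *_) (+-suc a (h % a)) ⟩
    weight h * suc (a + h % a)           ≡⟨ *-suc (weight h) (a + h % a) ⟩
    weight h + potential h               ≡⟨ +-comm (weight h) (potential h) ⟩
    potential h + weight h               ∎
    where
    open ≡-Reasoning
    increment : suc (h % a) < a ⊎ suc (h % a) ≡ a →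
                potential (suc (h % a) + h / a * a) ≡ weight h * (a + suc (h % a))
    increment (inj₁ 1+r<a) = potential-digits (h / a) 1+r<a
    increment (inj₂ 1+r≡a) = begin
      potential (suc (h % a) + h / a * a)  ≡⟨ cong (λ r → potential (r + h / a * a)) 1+r≡a ⟩
      potential (0 + suc (h / a) * a)      ≡⟨ potential-digits (suc (h / a)) (>-nonZero⁻¹ a) ⟩
      2 * weight h * (a + 0)               ≡⟨ doubling (weight h) a ⟩
      weight h * (a + a)                   ≡⟨ cong (λ r → weight h * (a + r)) 1+r≡a ⟨
      weight h * (a + suc (h % a))         ∎
      where
      doubling : ∀ x a → 2 * x * (a + 0) ≡ x * (a + a)
      doubling x a = solve (x ∷ a ∷ [])

  potential-zero : potential 0 ≡ a
  potential-zero = trans (potential-digits 0 (>-nonZero⁻¹ a)) (trans (+-identityʳ (a + 0)) (+-identityʳ a))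

  weight-mono-≤ : ∀ {h h′} → h ≤ h′ → weight h ≤ weight h′
  weight-mono-≤ h≤h′ = ^-monoʳ-≤ 2 (/-monoˡ-≤ a h≤h′)

  weight*a≤potential : ∀ h → weight h * a ≤ potential h
  weight*a≤potential h = *-monoʳ-≤ (weight h) (m≤m+n a (h % a))

  potential≤2^m*a⇒h<[1+m]*a : ∀ {h} m → potential h ≤ 2 ^ m * a → h < suc m * a
  potential≤2^m*a⇒h<[1+m]*a {h} m potential≤ = begin-strict
    h                  ≡⟨ m≡m%n+[m/n]*n h a ⟩
    h % a + h / a * a  <⟨ +-mono-<-≤ (m%n<n h a) (*-monoˡ-≤ a h/a≤m) ⟩
    a + m * a          ∎
    where
    open ≤-Reasoning
    h/a≤m : h / a ≤ m
    h/a≤m = ^-cancelʳ-≤ 2 (n<1+n 1) (*-cancelʳ-≤ (weight h) (2 ^ m) a (≤-trans (weight*a≤potential h) potential≤))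

⟦_⟧ : Bool → ℕ
⟦ true  ⟧ = 1
⟦ false ⟧ = 0

module _ {n : ℕ} where

  rowMass : Rect n → (𝔹 n → ℕ) → ℕ
  rowMass R w = ∑[ y ∈ all𝔹 n ] (⟦ hitsHLine y R ⟧ * w y)

  colMass : Rect n → (𝔹 n → ℕ) → ℕ
  colMass R w = ∑[ x ∈ all𝔹 n ] (⟦ hitsVLine x R ⟧ * w x)

  rowMass-mono-≤ : ∀ R {v w : 𝔹 n → ℕ} → (∀ y → v y ≤ w y) → rowMass R v ≤ rowMass R w
  rowMass-mono-≤ R v≤w = ∑-mono-≤ (all𝔹 n) (λ y → *-monoʳ-≤ ⟦ hitsHLine y R ⟧ (v≤w y))

  colMass-mono-≤ : ∀ R {v w : 𝔹 n → ℕ} → (∀ x → v x ≤ w x) → colMass R v ≤ colMass R w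
  colMass-mono-≤ R v≤w = ∑-mono-≤ (all𝔹 n) (λ x → *-monoʳ-≤ ⟦ hitsVLine x R ⟧ (v≤w x))

  ⟦hitsHLine⟧*⟦hitsVLine⟧≤⟦∈R⟧ : ∀ (R : Rect n) x y →
    ⟦ hitsHLine y R ⟧ * ⟦ hitsVLine x R ⟧ ≤ ⟦ U R x ∧ V R y ⟧
  ⟦hitsHLine⟧*⟦hitsVLine⟧≤⟦∈R⟧ R x y with any (U R) (all𝔹 n) | U R x | V R y | any (V R) (all𝔹 n)
  ... | false | _     | _     | _     = z≤n
  ... | true  | _     | false | _     = z≤n
  ... | true  | false | true  | _     = z≤n
  ... | true  | true  | true  | false = z≤n
  ... | true  | true  | true  | true  = ≤-refl

  rowMass*colMass≤∑∑⟦∈R⟧ : ∀ R (gr gc : 𝔹 n → ℕ) →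
    rowMass R gr * colMass R gc ≤ ∑[ y ∈ all𝔹 n ] ∑[ x ∈ all𝔹 n ] (⟦ U R x ∧ V R y ⟧ * (gr y * gc x))
  rowMass*colMass≤∑∑⟦∈R⟧ R gr gc = begin
    rowMass R gr * colMass R gc
      ≡⟨ ∑*∑≡∑∑* (all𝔹 n) (all𝔹 n) _ _ ⟩
    ∑[ y ∈ all𝔹 n ] ∑[ x ∈ all𝔹 n ] ((⟦ hitsHLine y R ⟧ * gr y) * (⟦ hitsVLine x R ⟧ * gc x))
      ≤⟨ ∑-mono-≤ (all𝔹 n) (λ y → ∑-mono-≤ (all𝔹 n) (λ x → pointwise y x)) ⟩
    ∑[ y ∈ all𝔹 n ] ∑[ x ∈ all𝔹 n ] (⟦ U R x ∧ V R y ⟧ * (gr y * gc x))  ∎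
    where
    open ≤-Reasoning
    pointwise : ∀ y x →
      (⟦ hitsHLine y R ⟧ * gr y) * (⟦ hitsVLine x R ⟧ * gc x) ≤ ⟦ U R x ∧ V R y ⟧ * (gr y * gc x)
    pointwise y x = ≤-trans (≤-reflexive (*-interchange ⟦ hitsHLine y R ⟧ (gr y) ⟦ hitsVLine x R ⟧ (gc x)))
                            (*-monoˡ-≤ (gr y * gc x) (⟦hitsHLine⟧*⟦hitsVLine⟧≤⟦∈R⟧ R x y))

  Disjoint : History n → Set
  Disjoint []            = ⊤
  Disjoint ((R , _) ∷ h) = Fresh R h × Disjoint h

  coverage : History n → 𝔹 n → 𝔹 n → ℕ
  coverage h x y = ∑[ e ∈ h ] ⟦ U (proj₁ e) x ∧ V (proj₁ e) y ⟧

  Fresh⇒coverage≡0 : ∀ {R} h {x y} → Fresh R h → (x , y) ∈R R → coverage h x y ≡ 0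
  Fresh⇒coverage≡0 []            _             _    = refl
  Fresh⇒coverage≡0 ((S , _) ∷ h) {x} {y} (R#S , fresh) xy∈R with U S x ∧ V S y in xy∈S
  ... | true  = ⊥-elim (R#S x y xy∈R xy∈S)
  ... | false = Fresh⇒coverage≡0 h fresh xy∈R

  Disjoint⇒coverage≤1 : ∀ h {x y} → Disjoint h → coverage h x y ≤ 1
  Disjoint⇒coverage≤1 []            _                = z≤n
  Disjoint⇒coverage≤1 ((R , _) ∷ h) {x} {y} (fresh , disjoint) with U R x ∧ V R y in xy∈R
  ... | true  = ≤-reflexive (cong suc (Fresh⇒coverage≡0 h fresh xy∈R))
  ... | false = Disjoint⇒coverage≤1 h disjoint

  ∑rowMass*colMass≤∑*∑ : ∀ h → Disjoint h → (gr gc : 𝔹 n → ℕ) →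
    ∑[ e ∈ h ] (rowMass (proj₁ e) gr * colMass (proj₁ e) gc) ≤ ∑ (all𝔹 n) gr * ∑ (all𝔹 n) gc
  ∑rowMass*colMass≤∑*∑ h disjoint gr gc = begin
    ∑[ e ∈ h ] (rowMass (proj₁ e) gr * colMass (proj₁ e) gc)
      ≤⟨ ∑-mono-≤ h (λ e → rowMass*colMass≤∑∑⟦∈R⟧ (proj₁ e) gr gc) ⟩
    ∑[ e ∈ h ] ∑[ y ∈ L ] ∑[ x ∈ L ] (⟦ U (proj₁ e) x ∧ V (proj₁ e) y ⟧ * (gr y * gc x))
      ≡⟨ ∑-comm h L _ ⟩
    ∑[ y ∈ L ] ∑[ e ∈ h ] ∑[ x ∈ L ] (⟦ U (proj₁ e) x ∧ V (proj₁ e) y ⟧ * (gr y * gc x))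
      ≡⟨ ∑-cong L (λ y → ∑-comm h L _) ⟩
    ∑[ y ∈ L ] ∑[ x ∈ L ] ∑[ e ∈ h ] (⟦ U (proj₁ e) x ∧ V (proj₁ e) y ⟧ * (gr y * gc x))
      ≡⟨ ∑-cong L (λ y → ∑-cong L (λ x → *-distribʳ-∑ h (gr y * gc x) _)) ⟨
    ∑[ y ∈ L ] ∑[ x ∈ L ] (coverage h x y * (gr y * gc x))
      ≤⟨ ∑-mono-≤ L (λ y → ∑-mono-≤ L (λ x →
           *-monoˡ-≤ (gr y * gc x) (Disjoint⇒coverage≤1 h disjoint))) ⟩
    ∑[ y ∈ L ] ∑[ x ∈ L ] (1 * (gr y * gc x))
      ≡⟨ ∑-cong L (λ y → ∑-cong L (λ x → *-identityˡ (gr y * gc x))) ⟩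
    ∑[ y ∈ L ] ∑[ x ∈ L ] (gr y * gc x)
      ≡⟨ ∑*∑≡∑∑* L L gr gc ⟨
    ∑ L gr * ∑ L gc  ∎
    where
    open ≤-Reasoning
    L : List (𝔹 n)
    L = all𝔹 n

  countH-mono-∷ : ∀ y e (h : History n) → countH y h ≤ countH y (e ∷ h)
  countH-mono-∷ y (R , vertical)   h = ≤-refl
  countH-mono-∷ y (R , horizontal) h with hitsHLine y R
  ... | true  = n≤1+n (countH y h)
  ... | false = ≤-refl

  countV-mono-∷ : ∀ x e (h : History n) → countV x h ≤ countV x (e ∷ h)
  countV-mono-∷ x (R , horizontal) h = ≤-refl
  countV-mono-∷ x (R , vertical)   h with hitsVLine x R
  ... | true  = n≤1+n (countV x h)
  ... | false = ≤-refl

module Strategy (n a b : ℕ) .{{_ : NonZero a}} .{{_ : NonZero b}} where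

  module Row = Potential a
  module Col = Potential b

  rowWeight colWeight : History n → 𝔹 n → ℕ
  rowWeight h y = Row.weight (countH y h)
  colWeight h x = Col.weight (countV x h)

  Φ : History n → ℕ
  Φ h = b * (∑[ y ∈ all𝔹 n ] Row.potential (countH y h)) + a * (∑[ x ∈ all𝔹 n ] Col.potential (countV x h))

  cost : (𝔹 n → ℕ) → (𝔹 n → ℕ) → Rect n → ℕ
  cost gr gc R = (b * rowMass R gr) ⊓ (a * colMass R gc)

  cost-mono-≤ : ∀ R {gr gr′ gc gc′ : 𝔹 n → ℕ} → (∀ y → gr y ≤ gr′ y) → (∀ x → gc x ≤ gc′ x) →
                cost gr gc R ≤ cost gr′ gc′ R
  cost-mono-≤ R {gr} {gr′} {gc} {gc′} gr≤gr′ gc≤gc′ =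
    ⊓-mono-≤ (*-monoʳ-≤ b (rowMass-mono-≤ R gr≤gr′)) (*-monoʳ-≤ a (colMass-mono-≤ R gc≤gc′))

  Φ-horizontal : ∀ R h → Φ ((R , horizontal) ∷ h) ≡ Φ h + b * rowMass R (rowWeight h)
  Φ-horizontal R h = begin
    b * (∑[ y ∈ all𝔹 n ] Row.potential (countH y ((R , horizontal) ∷ h))) + a * cols
      ≡⟨ cong (λ r → b * r + a * cols) (trans (∑-cong (all𝔹 n) potential-update) (∑-distrib-+ (all𝔹 n) _ _)) ⟩
    b * (rows + rowMass R (rowWeight h)) + a * cols
      ≡⟨ shape rows (rowMass R (rowWeight h)) cols ⟩
    Φ h + b * rowMass R (rowWeight h)  ∎
    where
    open ≡-Reasoning
    rows cols : ℕ
    rows = ∑[ y ∈ all𝔹 n ] Row.potential (countH y h)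
    cols = ∑[ x ∈ all𝔹 n ] Col.potential (countV x h)
    potential-update : ∀ y → Row.potential (countH y ((R , horizontal) ∷ h))
                             ≡ Row.potential (countH y h) + ⟦ hitsHLine y R ⟧ * rowWeight h y
    potential-update y with hitsHLine y R
    ... | true  = trans (Row.potential-suc (countH y h)) (cong (Row.potential (countH y h) +_) (sym (+-identityʳ _)))
    ... | false = sym (+-identityʳ _)
    shape : ∀ r m c → b * (r + m) + a * c ≡ b * r + a * c + b * m
    shape r m c = solve (r ∷ m ∷ c ∷ a ∷ b ∷ [])

  Φ-vertical : ∀ R h → Φ ((R , vertical) ∷ h) ≡ Φ h + a * colMass R (colWeight h)
  Φ-vertical R h = begin
    b * rows + a * (∑[ x ∈ all𝔹 n ] Col.potential (countV x ((R , vertical) ∷ h)))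
      ≡⟨ cong (λ c → b * rows + a * c) (trans (∑-cong (all𝔹 n) potential-update) (∑-distrib-+ (all𝔹 n) _ _)) ⟩
    b * rows + a * (cols + colMass R (colWeight h))
      ≡⟨ shape rows cols (colMass R (colWeight h)) ⟩
    Φ h + a * colMass R (colWeight h)  ∎
    where
    open ≡-Reasoning
    rows cols : ℕ
    rows = ∑[ y ∈ all𝔹 n ] Row.potential (countH y h)
    cols = ∑[ x ∈ all𝔹 n ] Col.potential (countV x h)
    potential-update : ∀ x → Col.potential (countV x ((R , vertical) ∷ h))
                             ≡ Col.potential (countV x h) + ⟦ hitsVLine x R ⟧ * colWeight h x
    potential-update x with hitsVLine x R
    ... | true  = trans (Col.potential-suc (countV x h)) (cong (Col.potential (countV x h) +_) (sym (+-identityʳ _)))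
    ... | false = sym (+-identityʳ _)
    shape : ∀ r c m → b * r + a * (c + m) ≡ b * r + a * c + a * m
    shape r c m = solve (r ∷ c ∷ m ∷ a ∷ b ∷ [])

  greedy-label : ∀ R h → Σ Label λ l → Φ ((R , l) ∷ h) ≤ Φ h + cost (rowWeight h) (colWeight h) R
  greedy-label R h with ≤-total (b * rowMass R (rowWeight h)) (a * colMass R (colWeight h))
  ... | inj₁ H≤V = horizontal , ≤-reflexive (trans (Φ-horizontal R h) (cong (Φ h +_) (sym (m≤n⇒m⊓n≡m H≤V))))
  ... | inj₂ V≤H = vertical   , ≤-reflexive (trans (Φ-vertical R h) (cong (Φ h +_) (sym (m≥n⇒m⊓n≡n V≤H))))

  Greedy : History n → Set
  Greedy []            = ⊤
  Greedy ((R , l) ∷ h) = Φ ((R , l) ∷ h) ≤ Φ h + cost (rowWeight h) (colWeight h) R × Greedy h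

  Φ≤Φ[]+∑cost : ∀ h → Greedy h → {gr gc : 𝔹 n → ℕ} →
                (∀ y → rowWeight h y ≤ gr y) → (∀ x → colWeight h x ≤ gc x) →
                Φ h ≤ Φ [] + ∑[ e ∈ h ] cost gr gc (proj₁ e)
  Φ≤Φ[]+∑cost []            _                _    _    = ≤-reflexive (sym (+-identityʳ (Φ [])))
  Φ≤Φ[]+∑cost ((R , l) ∷ h) (greedy-step , greedy) {gr} {gc} h≤gr h≤gc = begin
    Φ ((R , l) ∷ h)
      ≤⟨ greedy-step ⟩
    Φ h + cost (rowWeight h) (colWeight h) R
      ≤⟨ +-mono-≤ (Φ≤Φ[]+∑cost h greedy h′≤gr h′≤gc) (cost-mono-≤ R h′≤gr h′≤gc) ⟩
    Φ [] + ∑[ e ∈ h ] cost gr gc (proj₁ e) + cost gr gc R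
      ≡⟨ +-assoc (Φ []) _ _ ⟩
    Φ [] + (∑[ e ∈ h ] cost gr gc (proj₁ e) + cost gr gc R)
      ≡⟨ cong (Φ [] +_) (+-comm _ (cost gr gc R)) ⟩
    Φ [] + ∑[ e ∈ (R , l) ∷ h ] cost gr gc (proj₁ e)  ∎
    where
    open ≤-Reasoning
    h′≤gr : ∀ y → rowWeight h y ≤ gr y
    h′≤gr y = ≤-trans (Row.weight-mono-≤ (countH-mono-∷ y (R , l) h)) (h≤gr y)
    h′≤gc : ∀ x → colWeight h x ≤ gc x
    h′≤gc x = ≤-trans (Col.weight-mono-≤ (countV-mono-∷ x (R , l) h)) (h≤gc x)

  totalCost : History n → ℕ
  totalCost h = ∑[ e ∈ h ] cost (rowWeight h) (colWeight h) (proj₁ e)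

  totalCost²≤[ab]²*∑*∑ : ∀ h → Disjoint h → length h ≡ a * b →
    totalCost h * totalCost h ≤ a * b * (a * b) * (∑ (all𝔹 n) (rowWeight h) * ∑ (all𝔹 n) (colWeight h))
  totalCost²≤[ab]²*∑*∑ h disjoint |h|≡ab = begin
    totalCost h * totalCost h
      ≤⟨ ∑⊓-cauchy-schwarz h _ _ ⟩
    length h * ∑[ e ∈ h ] (b * rowMass (proj₁ e) gr * (a * colMass (proj₁ e) gc))
      ≡⟨ cong₂ _*_ |h|≡ab (∑-cong h (λ e → rearrange (rowMass (proj₁ e) gr) (colMass (proj₁ e) gc))) ⟩
    a * b * ∑[ e ∈ h ] (a * b * (rowMass (proj₁ e) gr * colMass (proj₁ e) gc))
      ≡⟨ cong (a * b *_) (*-distribˡ-∑ h (a * b) _) ⟨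
    a * b * (a * b * ∑[ e ∈ h ] (rowMass (proj₁ e) gr * colMass (proj₁ e) gc))
      ≤⟨ *-monoʳ-≤ (a * b) (*-monoʳ-≤ (a * b) (∑rowMass*colMass≤∑*∑ h disjoint gr gc)) ⟩
    a * b * (a * b * (∑ (all𝔹 n) gr * ∑ (all𝔹 n) gc))
      ≡⟨ *-assoc (a * b) (a * b) _ ⟨
    a * b * (a * b) * (∑ (all𝔹 n) gr * ∑ (all𝔹 n) gc)  ∎
    where
    open ≤-Reasoning
    gr gc : 𝔹 n → ℕ
    gr = rowWeight h
    gc = colWeight h
    rearrange : ∀ p q → b * p * (a * q) ≡ a * b * (p * q)
    rearrange p q = solve (p ∷ q ∷ a ∷ b ∷ [])

  ab*∑rowWeight+ab*∑colWeight≤Φ : ∀ h →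
    a * b * ∑ (all𝔹 n) (rowWeight h) + a * b * ∑ (all𝔹 n) (colWeight h) ≤ Φ h
  ab*∑rowWeight+ab*∑colWeight≤Φ h = +-mono-≤ rows cols
    where
    open ≤-Reasoning
    ab*x≡b*[x*a] : ∀ x → a * b * x ≡ b * (x * a)
    ab*x≡b*[x*a] x = solve (x ∷ a ∷ b ∷ [])
    ab*x≡a*[x*b] : ∀ x → a * b * x ≡ a * (x * b)
    ab*x≡a*[x*b] x = solve (x ∷ a ∷ b ∷ [])
    rows : a * b * ∑ (all𝔹 n) (rowWeight h) ≤ b * ∑[ y ∈ all𝔹 n ] Row.potential (countH y h)
    rows = begin
      a * b * ∑ (all𝔹 n) (rowWeight h)         ≡⟨ ab*x≡b*[x*a] (∑ (all𝔹 n) (rowWeight h)) ⟩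
      b * (∑ (all𝔹 n) (rowWeight h) * a)       ≡⟨ cong (b *_) (*-distribʳ-∑ (all𝔹 n) a (rowWeight h)) ⟩
      b * ∑[ y ∈ all𝔹 n ] (rowWeight h y * a)
        ≤⟨ *-monoʳ-≤ b (∑-mono-≤ (all𝔹 n) (λ y → Row.weight*a≤potential (countH y h))) ⟩
      b * ∑[ y ∈ all𝔹 n ] Row.potential (countH y h) ∎
    cols : a * b * ∑ (all𝔹 n) (colWeight h) ≤ a * ∑[ x ∈ all𝔹 n ] Col.potential (countV x h)
    cols = begin
      a * b * ∑ (all𝔹 n) (colWeight h)         ≡⟨ ab*x≡a*[x*b] (∑ (all𝔹 n) (colWeight h)) ⟩
      a * (∑ (all𝔹 n) (colWeight h) * b)       ≡⟨ cong (a *_) (*-distribʳ-∑ (all𝔹 n) b (colWeight h)) ⟩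
      a * ∑[ x ∈ all𝔹 n ] (colWeight h x * b)
        ≤⟨ *-monoʳ-≤ a (∑-mono-≤ (all𝔹 n) (λ x → Col.weight*a≤potential (countV x h))) ⟩
      a * ∑[ x ∈ all𝔹 n ] Col.potential (countV x h) ∎

  2*totalCost≤Φ : ∀ h → Disjoint h → length h ≡ a * b → 2 * totalCost h ≤ Φ h
  2*totalCost≤Φ h disjoint |h|≡ab = ≤-trans
    (m*m≤n*n*[o*p]⇒2*m≤n*o+n*p (totalCost h) (a * b) (∑ (all𝔹 n) (rowWeight h)) (∑ (all𝔹 n) (colWeight h))
      (totalCost²≤[ab]²*∑*∑ h disjoint |h|≡ab))
    (ab*∑rowWeight+ab*∑colWeight≤Φ h)

  2*Φ[]≡2^[2+n]*ab : 2 * Φ [] ≡ 2 ^ (2 + n) * (a * b)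
  2*Φ[]≡2^[2+n]*ab = begin
    2 * (b * (∑[ y ∈ all𝔹 n ] Row.potential 0) + a * (∑[ x ∈ all𝔹 n ] Col.potential 0))
      ≡⟨ cong₂ (λ r c → 2 * (b * r + a * c))
           (trans (∑-cong (all𝔹 n) (λ _ → Row.potential-zero)) (∑-all𝔹-const n a))
           (trans (∑-cong (all𝔹 n) (λ _ → Col.potential-zero)) (∑-all𝔹-const n b)) ⟩
    2 * (b * (a * 2 ^ n) + a * (b * 2 ^ n))
      ≡⟨ collect (2 ^ n) ⟩
    2 ^ (2 + n) * (a * b)  ∎
    where
    open ≡-Reasoning
    collect : ∀ x → 2 * (b * (a * x) + a * (b * x)) ≡ 2 * (2 * x) * (a * b)
    collect x = solve (x ∷ a ∷ b ∷ [])

  Φ≤2^[2+n]*ab : ∀ h → Disjoint h → Greedy h → length h ≡ a * b → Φ h ≤ 2 ^ (2 + n) * (a * b)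
  Φ≤2^[2+n]*ab h disjoint greedy |h|≡ab = ≤-trans
    (m≤n+o⇒2*o≤m⇒m≤2*n {n = Φ []} (Φ≤Φ[]+∑cost h greedy (λ _ → ≤-refl) (λ _ → ≤-refl))
                                  (2*totalCost≤Φ h disjoint |h|≡ab))
    (≤-reflexive 2*Φ[]≡2^[2+n]*ab)

  countH<[3+n]*a : ∀ h → Disjoint h → Greedy h → length h ≡ a * b → ∀ y → countH y h < (3 + n) * a
  countH<[3+n]*a h disjoint greedy |h|≡ab y = Row.potential≤2^m*a⇒h<[1+m]*a (2 + n) (*-cancelˡ-≤ b (begin
    b * Row.potential (countH y h)
      ≤⟨ *-monoʳ-≤ b (∈⇒≤∑ (λ z → Row.potential (countH z h)) (∈-all𝔹 y)) ⟩
    b * (∑[ z ∈ all𝔹 n ] Row.potential (countH z h)) ≤⟨ m≤m+n _ _ ⟩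
    Φ h                                              ≤⟨ Φ≤2^[2+n]*ab h disjoint greedy |h|≡ab ⟩
    2 ^ (2 + n) * (a * b)                            ≡⟨ x*ab≡b*[x*a] (2 ^ (2 + n)) ⟩
    b * (2 ^ (2 + n) * a)                            ∎))
    where
    open ≤-Reasoning
    x*ab≡b*[x*a] : ∀ x → x * (a * b) ≡ b * (x * a)
    x*ab≡b*[x*a] x = solve (x ∷ a ∷ b ∷ [])

  countV<[3+n]*b : ∀ h → Disjoint h → Greedy h → length h ≡ a * b → ∀ x → countV x h < (3 + n) * b
  countV<[3+n]*b h disjoint greedy |h|≡ab x = Col.potential≤2^m*a⇒h<[1+m]*a (2 + n) (*-cancelˡ-≤ a (begin
    a * Col.potential (countV x h)
      ≤⟨ *-monoʳ-≤ a (∈⇒≤∑ (λ z → Col.potential (countV z h)) (∈-all𝔹 x)) ⟩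
    a * (∑[ z ∈ all𝔹 n ] Col.potential (countV z h)) ≤⟨ m≤n+m _ _ ⟩
    Φ h                                              ≤⟨ Φ≤2^[2+n]*ab h disjoint greedy |h|≡ab ⟩
    2 ^ (2 + n) * (a * b)                            ≡⟨ x*ab≡a*[x*b] (2 ^ (2 + n)) ⟩
    a * (2 ^ (2 + n) * b)                            ∎))
    where
    open ≤-Reasoning
    x*ab≡a*[x*b] : ∀ x → x * (a * b) ≡ a * (x * b)
    x*ab≡a*[x*b] x = solve (x ∷ a ∷ b ∷ [])

  strategy : ∀ t h → Disjoint h → Greedy h → t + length h ≡ a * b → SecondWinsFrom n a b (3 + n) t h
  strategy zero    h disjoint greedy |h|≡ab =
    (λ y → <⇒≤ (countH<[3+n]*a h disjoint greedy |h|≡ab y)) ,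
    (λ x → <⇒≤ (countV<[3+n]*b h disjoint greedy |h|≡ab x))
  strategy (suc t) h disjoint greedy t+1+|h|≡ab R fresh with greedy-label R h
  ... | l , step = l , strategy t ((R , l) ∷ h) (fresh , disjoint) (step , greedy) (trans (+-suc t (length h)) t+1+|h|≡ab)

  second-wins : SecondHasWinningStrategy n a b (3 + n)
  second-wins = strategy (a * b) [] _ _ (+-identityʳ (a * b))

evalPoly-3∷1∷[] : ∀ n → evalPoly (3 ∷ 1 ∷ []) n ≡ 3 + n
evalPoly-3∷1∷[] n = cong (3 +_) (trans (cong (λ m → n * suc m) (*-zeroʳ n)) (*-identityʳ n))

theorem2 : Σ (List ℕ) (λ p → (n a b : ℕ) → 1 ≤ n → 1 ≤ a → 1 ≤ b →
             SecondHasWinningStrategy n a b (evalPoly p n))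
theorem2 = (3 ∷ 1 ∷ []) , λ n a b _ 1≤a 1≤b →
  subst (SecondHasWinningStrategy n a b) (sym (evalPoly-3∷1∷[] n))
        (Strategy.second-wins n a b {{>-nonZero 1≤a}} {{>-nonZero 1≤b}})
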